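{- For an integer $n\ge3$ let $w_n=(1,2,2,3,4,5,\dots,n)$ (the integers $1,\dots,n$ with an extra $2$), and let $\nu(w_n;a,b)$ be $\nu$ of $w_n$ with $a,b$ adjoined. Then $\nu(w_n)=2(-2+n+n^2)$, and with $$P_n(u)=3(n+2)^3+2(n^2+20)u-4(3n+2)u^2-8u^3,\qquad h_n(u,y)=-3y^2+\tfrac1{16}(2u+n+2)P_n(u),$$ one has, as a polynomial identity in $a,b$, $$h_n\Big(\frac{a+b}2-\frac{n+2}2,\ \frac{a^2-b^2}4\Big)=\frac14(a+b)\,\nu(w_n;a,b).$$
   Context: For a finite sequence $(a_1,\dots,a_M)$ (repetitions allowed), $\nu(a_1,\dots,a_M)=\big(\sum a_i\big)^2-\sum a_i^3$. -}

module Defs where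

open import Data.Nat using (ℕ; suc)
open import Data.Integer using (+_)
open import Data.Rational using (ℚ; _+_; _*_; _-_; _/_)
open import Data.List using (List; []; _∷_; map; foldr; upTo)

⟦_⟧ : ℕ → ℚ
⟦ k ⟧ = (+ k) / 1

sumℚ : List ℚ → ℚ
sumℚ = foldr _+_ (⟦ 0 ⟧)

cube : ℚ → ℚ
cube x = x * x * x

ν : List ℚ → ℚ
ν xs = sumℚ xs * sumℚ xs - sumℚ (map cube xs)

w : ℕ → List ℚ
w n = ⟦ 2 ⟧ ∷ map (λ k → ⟦ suc k ⟧) (upTo n)

νab : ℕ → ℚ → ℚ → ℚ
νab n a b = ν (a ∷ b ∷ w n)

P : ℕ → ℚ → ℚ
P n u = ⟦ 3 ⟧ * cube (⟦ n ⟧ + ⟦ 2 ⟧)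
      + ⟦ 2 ⟧ * (⟦ n ⟧ * ⟦ n ⟧ + ⟦ 20 ⟧) * u
      - ⟦ 4 ⟧ * (⟦ 3 ⟧ * ⟦ n ⟧ + ⟦ 2 ⟧) * (u * u)
      - ⟦ 8 ⟧ * cube u

h : ℕ → ℚ → ℚ → ℚ
h n u y = (⟦ 0 ⟧ - ⟦ 3 ⟧ * (y * y))
        + ((+ 1) / 16) * (⟦ 2 ⟧ * u + ⟦ n ⟧ + ⟦ 2 ⟧) * P n u

-- Both power sums of w_n are classical: Σ k = T n := n(n+1)/2 (Gauss) and
-- Σ k³ = T n² (Nicomachus), each proved by telescoping.  Hence ν(w_n) = (2 + T n)² − 8 − T n²,
-- and ν(w_n; a, b) depends on n only through T n.  The identity for h_n is then a polynomial
-- identity in a, b and n: since 4(a³ + b³) = (a + b)³ + 3(a + b)(a − b)², the quantity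
-- 4 ν(w_n; a, b) + 3(a + b)(a − b)² depends on a and b only through a + b = 2u + n + 2,
-- and as a cubic in u it is P_n(u).
module Submission where

open import Defs
open import Data.Nat using (ℕ; zero; suc; _≤_)
import Data.Nat.Properties as ℕ
open import Data.Integer using (+_)
import Data.Integer as ℤ
import Data.Integer.Properties as ℤ
open import Data.Rational using (ℚ; _+_; _*_; _-_; _/_; 0ℚ; _≟_)
open import Data.Rational.Properties
  using (normalize-coprime; +-assoc; +-identityˡ; +-identityʳ; +-*-commutativeRing)
import Data.Nat.Coprimality as Coprimality
open import Data.List using (List; []; _∷_; map; upTo; _++_)
open import Data.List.Properties using (upTo-∷ʳ; map-++; map-∘)
open import Data.Product using (_×_; _,_)
open import Level using (0ℓ)
open import Relation.Nullary.Decidable using (dec⇒maybe)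
open import Relation.Binary.PropositionalEquality
  using (_≡_; refl; sym; trans; cong; cong₂; module ≡-Reasoning)
open import Tactic.RingSolver using (solve-∀)
open import Tactic.RingSolver.Core.AlmostCommutativeRing
  using (AlmostCommutativeRing; fromCommutativeRing)

open ≡-Reasoning

-- The exact zero test on coefficients is what makes the solver's normal forms canonical.
ℚ-almostCommutativeRing : AlmostCommutativeRing 0ℓ 0ℓ
ℚ-almostCommutativeRing = fromCommutativeRing +-*-commutativeRing (λ p → dec⇒maybe (0ℚ ≟ p))

⟦⟧-suc : ∀ n → ⟦ suc n ⟧ ≡ ⟦ n ⟧ + ⟦ 1 ⟧
-- The last step holds because, with ⟦ n ⟧ in normal form, ⟦ n ⟧ + ⟦ 1 ⟧ computes to that fraction.
⟦⟧-suc n = begin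
  + (suc n) / 1                     ≡⟨ cong (λ m → + m / 1) (ℕ.+-comm 1 n) ⟩
  (+ n ℤ.+ + 1) / 1                 ≡⟨ cong (λ i → (i ℤ.+ + 1) / 1) (ℤ.*-identityʳ (+ n)) ⟨
  (+ n ℤ.* + 1 ℤ.+ + 1) / 1         ≡⟨ cong (_+ ⟦ 1 ⟧) (normalize-coprime (Coprimality.sym (Coprimality.1-coprimeTo n))) ⟨
  ⟦ n ⟧ + ⟦ 1 ⟧                     ∎

sumℚ-++ : ∀ xs ys → sumℚ (xs ++ ys) ≡ sumℚ xs + sumℚ ys
sumℚ-++ []       ys = sym (+-identityˡ (sumℚ ys))
sumℚ-++ (x ∷ xs) ys = trans (cong (λ s → x + s) (sumℚ-++ xs ys)) (sym (+-assoc x (sumℚ xs) (sumℚ ys)))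

sumℚ-upTo-suc : ∀ (f : ℕ → ℚ) n → sumℚ (map f (upTo (suc n))) ≡ sumℚ (map f (upTo n)) + f n
sumℚ-upTo-suc f n = begin
  sumℚ (map f (upTo (suc n)))               ≡⟨ cong sumℚ∘map (upTo-∷ʳ n) ⟨
  sumℚ (map f (upTo n ++ n ∷ []))           ≡⟨ cong sumℚ (map-++ f (upTo n) (n ∷ [])) ⟩
  sumℚ (map f (upTo n) ++ f n ∷ [])         ≡⟨ sumℚ-++ (map f (upTo n)) (f n ∷ []) ⟩
  sumℚ (map f (upTo n)) + (f n + ⟦ 0 ⟧)     ≡⟨ cong (λ s → sumℚ (map f (upTo n)) + s) (+-identityʳ (f n)) ⟩
  sumℚ (map f (upTo n)) + f n               ∎
  where
  sumℚ∘map : List ℕ → ℚ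
  sumℚ∘map ks = sumℚ (map f ks)

sumℚ-telescope : ∀ (f F : ℚ → ℚ) → F ⟦ 0 ⟧ ≡ ⟦ 0 ⟧ →
                 (∀ x → F (x + ⟦ 1 ⟧) ≡ F x + f (x + ⟦ 1 ⟧)) →
                 ∀ n → sumℚ (map (λ k → f ⟦ suc k ⟧) (upTo n)) ≡ F ⟦ n ⟧
sumℚ-telescope f F F0 step zero    = sym F0
sumℚ-telescope f F F0 step (suc n) = begin
  sumℚ (map (λ k → f ⟦ suc k ⟧) (upTo (suc n)))      ≡⟨ sumℚ-upTo-suc (λ k → f ⟦ suc k ⟧) n ⟩
  sumℚ (map (λ k → f ⟦ suc k ⟧) (upTo n)) + f ⟦ suc n ⟧
                                                      ≡⟨ cong₂ _+_ (sumℚ-telescope f F F0 step n) (cong f (⟦⟧-suc n)) ⟩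
  F ⟦ n ⟧ + f (⟦ n ⟧ + ⟦ 1 ⟧)                         ≡⟨ step ⟦ n ⟧ ⟨
  F (⟦ n ⟧ + ⟦ 1 ⟧)                                   ≡⟨ cong F (⟦⟧-suc n) ⟨
  F ⟦ suc n ⟧                                         ∎

triangular : ℚ → ℚ
triangular x = x * (x + ⟦ 1 ⟧) * ((+ 1) / 2)

-- The ring solver does not unfold definitions, so its goals below spell out ⟦_⟧-constants,
-- cube and triangular.
triangular-suc : ∀ x → (x + ⟦ 1 ⟧) * ((x + ⟦ 1 ⟧) + ⟦ 1 ⟧) * ((+ 1) / 2)
                       ≡ x * (x + ⟦ 1 ⟧) * ((+ 1) / 2) + (x + ⟦ 1 ⟧)
triangular-suc = solve-∀ ℚ-almostCommutativeRing

triangular²-suc : ∀ x →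
  let T  = x * (x + ⟦ 1 ⟧) * ((+ 1) / 2)
      T′ = (x + ⟦ 1 ⟧) * ((x + ⟦ 1 ⟧) + ⟦ 1 ⟧) * ((+ 1) / 2)
  in T′ * T′ ≡ T * T + (x + ⟦ 1 ⟧) * (x + ⟦ 1 ⟧) * (x + ⟦ 1 ⟧)
triangular²-suc = solve-∀ ℚ-almostCommutativeRing

sumℚ-naturals : ∀ n → sumℚ (map (λ k → ⟦ suc k ⟧) (upTo n)) ≡ triangular ⟦ n ⟧
sumℚ-naturals = sumℚ-telescope (λ x → x) triangular refl triangular-suc

sumℚ-cubes : ∀ n → sumℚ (map cube (map (λ k → ⟦ suc k ⟧) (upTo n)))
                   ≡ triangular ⟦ n ⟧ * triangular ⟦ n ⟧
sumℚ-cubes n = trans (cong sumℚ (sym (map-∘ (upTo n))))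
                     (sumℚ-telescope cube (λ x → triangular x * triangular x) refl triangular²-suc n)

sumℚ-w : ∀ n → sumℚ (w n) ≡ ⟦ 2 ⟧ + triangular ⟦ n ⟧
sumℚ-w n = cong (λ s → ⟦ 2 ⟧ + s) (sumℚ-naturals n)

sumℚ-cube-w : ∀ n → sumℚ (map cube (w n)) ≡ cube ⟦ 2 ⟧ + triangular ⟦ n ⟧ * triangular ⟦ n ⟧
sumℚ-cube-w n = cong (λ c → cube ⟦ 2 ⟧ + c) (sumℚ-cubes n)

ν-from-power-sums : ∀ xs {s c} → sumℚ xs ≡ s → sumℚ (map cube xs) ≡ c → ν xs ≡ s * s - c
ν-from-power-sums xs σ₁ σ₃ = cong₂ (λ s c → s * s - c) σ₁ σ₃

ν-w-polynomial : ∀ x →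
  let T = x * (x + ⟦ 1 ⟧) * ((+ 1) / 2)
  in (⟦ 2 ⟧ + T) * (⟦ 2 ⟧ + T) - (⟦ 2 ⟧ * ⟦ 2 ⟧ * ⟦ 2 ⟧ + T * T) ≡ ⟦ 2 ⟧ * ((x + x * x) - ⟦ 2 ⟧)
ν-w-polynomial = solve-∀ ℚ-almostCommutativeRing

h-polynomial : ∀ x a b →
  let u = (a + b) * ((+ 1) / 2) - (x + ⟦ 2 ⟧) * ((+ 1) / 2)
      y = (a * a - b * b) * ((+ 1) / 4)
      P = ⟦ 3 ⟧ * ((x + ⟦ 2 ⟧) * (x + ⟦ 2 ⟧) * (x + ⟦ 2 ⟧))
          + ⟦ 2 ⟧ * (x * x + ⟦ 20 ⟧) * u
          - ⟦ 4 ⟧ * (⟦ 3 ⟧ * x + ⟦ 2 ⟧) * (u * u)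
          - ⟦ 8 ⟧ * (u * u * u)
      T = x * (x + ⟦ 1 ⟧) * ((+ 1) / 2)
      s = a + (b + (⟦ 2 ⟧ + T))
  in (⟦ 0 ⟧ - ⟦ 3 ⟧ * (y * y)) + ((+ 1) / 16) * (⟦ 2 ⟧ * u + x + ⟦ 2 ⟧) * P
     ≡ ((+ 1) / 4) * (a + b) * (s * s - (a * a * a + (b * b * b + (⟦ 2 ⟧ * ⟦ 2 ⟧ * ⟦ 2 ⟧ + T * T))))
h-polynomial = solve-∀ ℚ-almostCommutativeRing

mainTheorem19 : (n : ℕ) → 3 ≤ n →
    (ν (w n) ≡ ⟦ 2 ⟧ * ((⟦ n ⟧ + ⟦ n ⟧ * ⟦ n ⟧) - ⟦ 2 ⟧))
    × ((a b : ℚ) →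
        h n (((a + b) * ((+ 1) / 2)) - ((⟦ n ⟧ + ⟦ 2 ⟧) * ((+ 1) / 2)))
            ((a * a - b * b) * ((+ 1) / 4))
        ≡ ((+ 1) / 4) * (a + b) * νab n a b)
mainTheorem19 n _ = ν-w , h-factorisation
  where
  ν-w : ν (w n) ≡ ⟦ 2 ⟧ * ((⟦ n ⟧ + ⟦ n ⟧ * ⟦ n ⟧) - ⟦ 2 ⟧)
  ν-w = trans (ν-from-power-sums (w n) (sumℚ-w n) (sumℚ-cube-w n)) (ν-w-polynomial ⟦ n ⟧)

  T : ℚ
  T = triangular ⟦ n ⟧

  νab-in-power-sums : ∀ a b →
    νab n a b ≡ (a + (b + (⟦ 2 ⟧ + T))) * (a + (b + (⟦ 2 ⟧ + T)))
                - (cube a + (cube b + (cube ⟦ 2 ⟧ + T * T)))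
  νab-in-power-sums a b =
    ν-from-power-sums (a ∷ b ∷ w n) (cong (λ s → a + (b + s)) (sumℚ-w n))
                                    (cong (λ c → cube a + (cube b + c)) (sumℚ-cube-w n))

  h-factorisation : ∀ a b →
    h n (((a + b) * ((+ 1) / 2)) - ((⟦ n ⟧ + ⟦ 2 ⟧) * ((+ 1) / 2))) ((a * a - b * b) * ((+ 1) / 4))
    ≡ ((+ 1) / 4) * (a + b) * νab n a b
  h-factorisation a b =
    trans (h-polynomial ⟦ n ⟧ a b) (cong (((+ 1) / 4) * (a + b) *_) (sym (νab-in-power-sums a b)))
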